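{- Let $k$ and $l$ be integers with $2 \leq k < l$ and let $S = kl + k - 1$. Suppose the real numbers in $[1,S]$ are colored red and blue so that there is no red solution to $x_1 + x_2 + \cdots + x_k = x_0$ and no blue solution to $x_1 + x_2 + \cdots + x_l = x_0$ (with all variables in $[1,S]$). If $1$ is blue, then $k$, $l$, and $l+1$ are red and $kl$ is blue.
   Context: A red (resp. blue) solution to an equation means numbers $x_0, x_1, \dots$ in the colored interval satisfying the equation, all colored red (resp. blue); the variables need not be distinct.
   Formalization: The colouring is of the rational numbers in $[1,S]$ in place of the real numbers in $[1,S]$, and the variables of every red or blue solution are taken in the rationals. -}

module Defs where

open import Data.Nat as ℕ using (ℕ; zero; suc)
open import Data.Integer using (+_)
open import Data.Rational using (ℚ; 0ℚ; _+_; _/_; _≤_)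
open import Data.Fin using (Fin; zero; suc)
open import Data.Product using (_×_; Σ)
open import Relation.Binary.PropositionalEquality using (_≡_)
open import Relation.Nullary using (¬_)

data Colour : Set where
  red blue : Colour

ℕ→ℚ : ℕ → ℚ
ℕ→ℚ n = + n / 1

sumℚ : ∀ {n} → (Fin n → ℚ) → ℚ
sumℚ {zero}  xs = 0ℚ
sumℚ {suc n} xs = xs zero + sumℚ (λ i → xs (suc i))

InInterval : ℕ → ℚ → Set
InInterval S x = (ℕ→ℚ 1 ≤ x) × (x ≤ ℕ→ℚ S)

Good : ℕ → (ℚ → Colour) → Colour → ℚ → Set
Good S c col x = InInterval S x × (c x ≡ col)

Solution : ℕ → (ℚ → Colour) → Colour → ℕ → Set
Solution S c col m =
  Σ ℚ λ x₀ → Σ (Fin m → ℚ) λ xs →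
    Good S c col x₀ × (∀ i → Good S c col (xs i)) × (sumℚ xs ≡ x₀)

{-# OPTIONS --safe #-}
-- Each conclusion holds because the opposite colour would give a monochromatic
-- solution inside [1, S]: l = 1 + ⋯ + 1 (l blue terms), kl = l + ⋯ + l (k red terms),
-- kl = k + ⋯ + k (l blue terms), and kl = (k - 1)(l + 1) + (l - k + 1)·1, a sum of
-- l blue terms once l + 1 and 1 are blue.
module Submission where

open import Defs
open import Data.Nat using (ℕ; _≤_; _<_; _+_; _*_; _∸_)
open import Data.Rational using (ℚ)
open import Data.Product using (_×_)
open import Relation.Binary.PropositionalEquality using (_≡_)
open import Relation.Nullary using (¬_)

open import Data.Nat using (zero; suc; s≤s; z≤n)
open import Data.Nat.Properties
  using (≤-refl; ≤-trans; <⇒≤; m≤m+n; m≤n*m; n≤1+n; +-monoʳ-≤; *-mono-≤; +-∸-assoc; *-identityʳ; *-comm;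
         m≤n⇒∃[o]m+o≡n)
import Data.Nat.Coprimality as Coprimality
open import Data.Nat.Tactic.RingSolver using (solve-∀)
open import Data.Integer using (+_; +≤+)
import Data.Integer as ℤ
open import Data.Integer.Properties using () renaming (*-identityʳ to ℤ-*-identityʳ)
open import Data.Rational using (mkℚ; *≤*; _/_) renaming (_+_ to _+ℚ_; _≤_ to _≤ℚ_)
open import Data.Rational.Properties using (normalize-coprime; +-identityˡ; +-assoc)
open import Data.Vec using (Vec; []; _∷_; _++_; replicate; lookup)
open import Data.Vec.Relation.Unary.All using (All; []; _∷_)
open import Data.Vec.Relation.Unary.All.Properties using (++⁺; lookup⁺)
open import Data.Product using (_,_)
open import Function using (_∘_)
open import Relation.Nullary using (contradiction)
open import Relation.Binary.PropositionalEquality using (refl; sym; trans; cong; cong₂; subst; subst₂; _≢_; module ≡-Reasoning)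

ℕ→ℚ≡mkℚ : ∀ n → ℕ→ℚ n ≡ mkℚ (+ n) 0 (Coprimality.sym (Coprimality.1-coprimeTo n))
ℕ→ℚ≡mkℚ n = normalize-coprime (Coprimality.sym (Coprimality.1-coprimeTo n))

ℕ→ℚ-homo-+ : ∀ m n → ℕ→ℚ (m + n) ≡ ℕ→ℚ m +ℚ ℕ→ℚ n
ℕ→ℚ-homo-+ m n = sym (trans (cong₂ _+ℚ_ (ℕ→ℚ≡mkℚ m) (ℕ→ℚ≡mkℚ n))
  (cong (_/ 1) (cong₂ ℤ._+_ (ℤ-*-identityʳ (+ m)) (ℤ-*-identityʳ (+ n)))))

ℕ→ℚ-mono-≤ : ∀ {m n} → m ≤ n → ℕ→ℚ m ≤ℚ ℕ→ℚ n
ℕ→ℚ-mono-≤ {m} {n} m≤n = subst₂ _≤ℚ_ (sym (ℕ→ℚ≡mkℚ m)) (sym (ℕ→ℚ≡mkℚ n))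
  (*≤* (subst₂ ℤ._≤_ (sym (ℤ-*-identityʳ (+ m))) (sym (ℤ-*-identityʳ (+ n))) (+≤+ m≤n)))

sumℚ-++ : ∀ {m n} (xs : Vec ℚ m) (ys : Vec ℚ n) →
          sumℚ (lookup (xs ++ ys)) ≡ sumℚ (lookup xs) +ℚ sumℚ (lookup ys)
sumℚ-++ []       ys = sym (+-identityˡ _)
sumℚ-++ (x ∷ xs) ys = trans (cong (x +ℚ_) (sumℚ-++ xs ys)) (sym (+-assoc x _ _))

sumℚ-replicate : ∀ n v → sumℚ (lookup (replicate n (ℕ→ℚ v))) ≡ ℕ→ℚ (n * v)
sumℚ-replicate zero    v = refl
sumℚ-replicate (suc n) v = trans (cong (ℕ→ℚ v +ℚ_) (sumℚ-replicate n v)) (sym (ℕ→ℚ-homo-+ v (n * v)))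

All-replicate : ∀ {P : ℚ → Set} n {x} → P x → All P (replicate n x)
All-replicate zero    px = []
All-replicate (suc n) px = px ∷ All-replicate n px

≢blue⇒≡red : ∀ {col} → col ≢ blue → col ≡ red
≢blue⇒≡red {red}  _       = refl
≢blue⇒≡red {blue} col≢blue = contradiction refl col≢blue

≢red⇒≡blue : ∀ {col} → col ≢ red → col ≡ blue
≢red⇒≡blue {blue} _      = refl
≢red⇒≡blue {red}  col≢red = contradiction refl col≢red

module Colouring (S : ℕ) (c : ℚ → Colour) {col : Colour} where

  Good-ℕ→ℚ : ∀ {n} → 1 ≤ n → n ≤ S → c (ℕ→ℚ n) ≡ col → Good S c col (ℕ→ℚ n)
  Good-ℕ→ℚ 1≤n n≤S cn = (ℕ→ℚ-mono-≤ 1≤n , ℕ→ℚ-mono-≤ n≤S) , cn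

  vec-solution : ∀ {m} (xs : Vec ℚ m) → All (Good S c col) xs →
                 Good S c col (sumℚ (lookup xs)) → Solution S c col m
  vec-solution xs good-xs good-sum = sumℚ (lookup xs) , lookup xs , good-sum , lookup⁺ good-xs , refl

  replicate-solution : ∀ m v → Good S c col (ℕ→ℚ v) → Good S c col (ℕ→ℚ (m * v)) →
                       Solution S c col m
  replicate-solution m v good-v good-mv = vec-solution (replicate m (ℕ→ℚ v))
    (All-replicate m good-v) (subst (Good S c col) (sym (sumℚ-replicate m v)) good-mv)

  two-block-solution : ∀ a v b w → Good S c col (ℕ→ℚ v) → Good S c col (ℕ→ℚ w) →
                       Good S c col (ℕ→ℚ (a * v + b * w)) → Solution S c col (a + b)
  two-block-solution a v b w good-v good-w good-sum =
    vec-solution (replicate a (ℕ→ℚ v) ++ replicate b (ℕ→ℚ w))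
      (++⁺ (All-replicate a good-v) (All-replicate b good-w))
      (subst (Good S c col) (sym sum≡) good-sum)
    where
    open ≡-Reasoning
    sum≡ : sumℚ (lookup (replicate a (ℕ→ℚ v) ++ replicate b (ℕ→ℚ w))) ≡ ℕ→ℚ (a * v + b * w)
    sum≡ = begin
      sumℚ (lookup (replicate a (ℕ→ℚ v) ++ replicate b (ℕ→ℚ w)))
        ≡⟨ sumℚ-++ (replicate a (ℕ→ℚ v)) (replicate b (ℕ→ℚ w)) ⟩
      sumℚ (lookup (replicate a (ℕ→ℚ v))) +ℚ sumℚ (lookup (replicate b (ℕ→ℚ w)))
        ≡⟨ cong₂ _+ℚ_ (sumℚ-replicate a v) (sumℚ-replicate b w) ⟩
      ℕ→ℚ (a * v) +ℚ ℕ→ℚ (b * w)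
        ≡⟨ sym (ℕ→ℚ-homo-+ (a * v) (b * w)) ⟩
      ℕ→ℚ (a * v + b * w) ∎

  l+1-and-1-solution : ∀ {k l} → 1 ≤ k → k ≤ l →
                       Good S c col (ℕ→ℚ 1) → Good S c col (ℕ→ℚ (l + 1)) → Good S c col (ℕ→ℚ (k * l)) →
                       Solution S c col l
  l+1-and-1-solution {suc j} (s≤s _) k≤l good-1 good-l+1 good-kl
    with a , refl ← m≤n⇒∃[o]m+o≡n (≤-trans (n≤1+n j) k≤l) =
    two-block-solution j (j + a + 1) a 1 good-l+1 good-1
      (subst (Good S c col ∘ ℕ→ℚ) (sym (kl-split j a)) good-kl)
    where
    kl-split : ∀ j a → j * (j + a + 1) + a * 1 ≡ suc j * (j + a)
    kl-split = solve-∀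

kl≤kl+k∸1 : ∀ k l → 1 ≤ k → k * l ≤ k * l + k ∸ 1
kl≤kl+k∸1 k l 1≤k = subst (k * l ≤_) (sym (+-∸-assoc (k * l) 1≤k)) (m≤m+n (k * l) (k ∸ 1))

l+1≤kl : ∀ {k l} → 2 ≤ k → 1 ≤ l → l + 1 ≤ k * l
l+1≤kl {suc j} {l} (s≤s 1≤j) 1≤l = +-monoʳ-≤ l (*-mono-≤ 1≤j 1≤l)

lemma3 : (k l : ℕ) → 2 ≤ k → k < l → (c : ℚ → Colour)
    → ¬ Solution (k * l + k ∸ 1) c red k
    → ¬ Solution (k * l + k ∸ 1) c blue l
    → c (ℕ→ℚ 1) ≡ blue
    → (c (ℕ→ℚ k) ≡ red) × (c (ℕ→ℚ l) ≡ red) × (c (ℕ→ℚ (l + 1)) ≡ red)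
    × (c (ℕ→ℚ (k * l)) ≡ blue)
lemma3 k@(suc _) l 2≤k k<l c no-red no-blue 1-blue = k-red , l-red , l+1-red , kl-blue
  where
  S = k * l + k ∸ 1
  open Colouring S c
  1≤k : 1 ≤ k
  1≤k = s≤s z≤n
  k≤l : k ≤ l
  k≤l = <⇒≤ k<l
  1≤l : 1 ≤ l
  1≤l = ≤-trans 1≤k k≤l
  kl≤S : k * l ≤ S
  kl≤S = kl≤kl+k∸1 k l 1≤k
  l≤S : l ≤ S
  l≤S = ≤-trans (m≤n*m l k) kl≤S
  1≤kl : 1 ≤ k * l
  1≤kl = ≤-trans 1≤l (m≤n*m l k)
  good-1 : Good S c blue (ℕ→ℚ 1)
  good-1 = Good-ℕ→ℚ ≤-refl (≤-trans 1≤l l≤S) 1-blue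
  l-red : c (ℕ→ℚ l) ≡ red
  l-red = ≢blue⇒≡red λ l-blue → no-blue (replicate-solution l 1 good-1
    (subst (Good S c blue ∘ ℕ→ℚ) (sym (*-identityʳ l)) (Good-ℕ→ℚ 1≤l l≤S l-blue)))
  kl-blue : c (ℕ→ℚ (k * l)) ≡ blue
  kl-blue = ≢red⇒≡blue λ kl-red → no-red (replicate-solution k l
    (Good-ℕ→ℚ 1≤l l≤S l-red) (Good-ℕ→ℚ 1≤kl kl≤S kl-red))
  good-kl : Good S c blue (ℕ→ℚ (k * l))
  good-kl = Good-ℕ→ℚ 1≤kl kl≤S kl-blue
  k-red : c (ℕ→ℚ k) ≡ red
  k-red = ≢blue⇒≡red λ k-blue → no-blue (replicate-solution l k
    (Good-ℕ→ℚ 1≤k (≤-trans k≤l l≤S) k-blue) (subst (Good S c blue ∘ ℕ→ℚ) (*-comm k l) good-kl))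
  l+1-red : c (ℕ→ℚ (l + 1)) ≡ red
  l+1-red = ≢blue⇒≡red λ l+1-blue → no-blue (l+1-and-1-solution 1≤k k≤l good-1
    (Good-ℕ→ℚ (≤-trans 1≤l (m≤m+n l 1)) (≤-trans (l+1≤kl 2≤k 1≤l) kl≤S) l+1-blue) good-kl)
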